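{- Let $C\subseteq\{0,1\}^m$ be a code and let $C'\subseteq C$ with $\mathrm{CL}(C')=\ell$. Let $T=\mathrm{Supp}(C')$ and let $C|_{\bar T}$ denote the code obtained from $C$ by deleting the coordinates in $T$. Then $\mathrm{CL}(C|_{\bar T})\le \mathrm{CL}(C)-\ell$.
   Context: For $C'\subseteq C$, $\mathrm{Supp}(C')=\{i\in[m]:\exists c\in C',\ c_i\neq0\}$, $\bar T=[m]\setminus T$, and $C|_{\bar T}=\{c|_{\bar T}:c\in C\}$. A chain of length $\ell$ in a set $D\subseteq\{0,1\}^A$ (coordinates indexed by a finite set $A$) is a pair of injective maps $a:[\ell]\to A$, $c:[\ell]\to D$ with $c(i)_{a(i)}=1$ for all $i$ and $c(i)_{a(j)}=0$ for all $1\le i<j\le\ell$; $\mathrm{CL}(D)$ is the maximum length of a chain in $D$. -}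

module Defs where

open import Level using (0ℓ)
open import Data.Nat using (ℕ; _≤_; _<_)
open import Data.Fin using (Fin)
open import Data.Bool using (Bool; true; false)
open import Data.Product using (Σ; ∃; _×_; proj₁)
open import Relation.Nullary using (¬_)
open import Relation.Unary using (Pred)
open import Relation.Binary.PropositionalEquality using (_≡_)

Word : Set → Set
Word A = A → Bool

_≗w_ : {A : Set} → Word A → Word A → Set
u ≗w v = ∀ x → u x ≡ v x

Code : Set → Set₁
Code A = Pred (Word A) 0ℓ

record Chain {A : Set} (D : Code A) (ℓ : ℕ) : Set where
  field
    a      : Fin ℓ → A
    c      : Fin ℓ → Word A
    c∈D    : ∀ i → D (c i)
    a-inj  : ∀ i j → a i ≡ a j → i ≡ j
    c-inj  : ∀ i j → c i ≗w c j → i ≡ j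
    diag   : ∀ i → c i (a i) ≡ true
    upper  : ∀ i j → Data.Fin._<_ i j → c i (a j) ≡ false

IsCL : {A : Set} → Code A → ℕ → Set
IsCL D n = Chain D n × (∀ k → Chain D k → k ≤ n)

_⊆c_ : {A : Set} → Code A → Code A → Set
C' ⊆c C = ∀ w → C' w → C w

Supp : {m : ℕ} → Code (Fin m) → Pred (Fin m) 0ℓ
Supp C' i = ∃ λ c → C' c × c i ≡ true

Compl : {m : ℕ} → Pred (Fin m) 0ℓ → Set
Compl {m} T = Σ (Fin m) (λ i → ¬ T i)

Restrict : {m : ℕ} → Code (Fin m) → (T : Pred (Fin m) 0ℓ) → Code (Compl T)
Restrict C T w = ∃ λ c → C c × (∀ x → w x ≡ c (proj₁ x))

{-# OPTIONS --safe #-}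
module Submission where

-- A chain in C' followed by the lift of a chain in C restricted to the complement of
-- T = Supp C' is again a chain in C: every word of C' vanishes outside T, in particular at
-- the pivot coordinates of the second chain, so the concatenation stays triangular.
-- Hence ℓ + CL(C|_T̄) ≤ CL(C).

open import Defs
open import Data.Nat using (ℕ; _≤_; _∸_; _+_)
import Data.Nat as ℕ
open import Data.Nat.Properties using (m+n≤o⇒m≤o∸n; +-comm; m≤m+n; <-≤-trans; <-asym; +-cancelˡ-<)
open import Data.Fin using (Fin; zero; suc; _↑ˡ_; _↑ʳ_; toℕ)
import Data.Fin as Fin
open import Data.Fin.Properties using (toℕ-↑ˡ; toℕ-↑ʳ; toℕ<n; <-cmp)
open import Data.Bool using (true; false)
open import Data.Bool.Properties using (not-¬; ¬-not)
open import Data.Product using (proj₁; proj₂; _,_)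
open import Data.Empty using (⊥-elim)
open import Relation.Binary using (tri<; tri≈; tri>)
open import Relation.Binary.PropositionalEquality using (_≡_; sym; trans; cong; subst; subst₂)
open import Relation.Nullary using (¬_)

data SplitView (l k : ℕ) : Fin (l + k) → Set where
  left  : (i : Fin l) → SplitView l k (i ↑ˡ k)
  right : (j : Fin k) → SplitView l k (l ↑ʳ j)

splitView : ∀ l {k} (x : Fin (l + k)) → SplitView l k x
splitView ℕ.zero    x       = right x
splitView (ℕ.suc l) zero    = left zero
splitView (ℕ.suc l) (suc x) with splitView l x
... | left i  = left (suc i)
... | right j = right j

↑ˡ-cancel-< : ∀ {l} k {i i′ : Fin l} → i ↑ˡ k Fin.< i′ ↑ˡ k → i Fin.< i′
↑ˡ-cancel-< k {i} {i′} = subst₂ ℕ._<_ (toℕ-↑ˡ i k) (toℕ-↑ˡ i′ k)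

↑ʳ-cancel-< : ∀ l {k} {j j′ : Fin k} → l ↑ʳ j Fin.< l ↑ʳ j′ → j Fin.< j′
↑ʳ-cancel-< l {j = j} {j′} lt =
  +-cancelˡ-< l (toℕ j) (toℕ j′) (subst₂ ℕ._<_ (toℕ-↑ʳ l j) (toℕ-↑ʳ l j′) lt)

↑ʳ≮↑ˡ : ∀ {l k} (j : Fin k) (i : Fin l) → ¬ (l ↑ʳ j Fin.< i ↑ˡ k)
↑ʳ≮↑ˡ {l} {k} j i lt = <-asym (subst₂ ℕ._<_ (toℕ-↑ʳ l j) (toℕ-↑ˡ i k) lt)
                              (<-≤-trans (toℕ<n i) (m≤m+n l (toℕ j)))

injective-if-separated-by-< : ∀ {ℓ} (R : Fin ℓ → Fin ℓ → Set) →
  (∀ {i j} → R i j → R j i) → (∀ {i j} → i Fin.< j → ¬ R i j) →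
  ∀ i j → R i j → i ≡ j
injective-if-separated-by-< R symm separated i j r with <-cmp i j
... | tri< i<j _ _ = ⊥-elim (separated i<j r)
... | tri≈ _ i≡j _ = i≡j
... | tri> _ _ j<i = ⊥-elim (separated j<i (symm r))

-- Injectivity of the pivots and of the words is forced by the triangular pattern alone.
module _ {A : Set} {D : Code A} {ℓ : ℕ} (a : Fin ℓ → A) (c : Fin ℓ → Word A)
         (c∈D : ∀ i → D (c i))
         (diag : ∀ i → c i (a i) ≡ true)
         (upper : ∀ i j → i Fin.< j → c i (a j) ≡ false) where

  triangular⇒a-injective : ∀ i j → a i ≡ a j → i ≡ j
  triangular⇒a-injective = injective-if-separated-by-< (λ i j → a i ≡ a j) sym
    λ {i} {j} i<j aᵢ≡aⱼ → not-¬ (diag i) (trans (cong (c i) aᵢ≡aⱼ) (upper i j i<j))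

  triangular⇒c-injective : ∀ i j → c i ≗w c j → i ≡ j
  triangular⇒c-injective = injective-if-separated-by-< (λ i j → c i ≗w c j) (λ e x → sym (e x))
    λ {i} {j} i<j cᵢ≗cⱼ → not-¬ (diag j) (trans (sym (cᵢ≗cⱼ (a j))) (upper i j i<j))

  triangular⇒chain : Chain D ℓ
  triangular⇒chain = record
    { a = a ; c = c ; c∈D = c∈D
    ; a-inj = triangular⇒a-injective
    ; c-inj = triangular⇒c-injective
    ; diag = diag ; upper = upper }

chain-mono : ∀ {A} {D E : Code A} {ℓ} → D ⊆c E → Chain D ℓ → Chain E ℓ
chain-mono D⊆E P = record
  { a = a ; c = c ; c∈D = λ i → D⊆E (c i) (c∈D i)
  ; a-inj = a-inj ; c-inj = c-inj ; diag = diag ; upper = upper }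
  where open Chain P

module _ {A : Set} {D : Code A} {l k : ℕ} (P : Chain D l) (Q : Chain D k)
         (P-vanishes-on-Q : ∀ i j → Chain.c P i (Chain.a Q j) ≡ false) where
  private
    module P = Chain P
    module Q = Chain Q

    a : ∀ {x} → SplitView l k x → A
    a (left i)  = P.a i
    a (right j) = Q.a j

    c : ∀ {x} → SplitView l k x → Word A
    c (left i)  = P.c i
    c (right j) = Q.c j

    c∈D : ∀ {x} (v : SplitView l k x) → D (c v)
    c∈D (left i)  = P.c∈D i
    c∈D (right j) = Q.c∈D j

    diag : ∀ {x} (v : SplitView l k x) → c v (a v) ≡ true
    diag (left i)  = P.diag i
    diag (right j) = Q.diag j

    upper : ∀ {x y} (u : SplitView l k x) (v : SplitView l k y) → x Fin.< y → c u (a v) ≡ false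
    upper (left i)  (left i′)  lt = P.upper i i′ (↑ˡ-cancel-< k lt)
    upper (left i)  (right j)  _  = P-vanishes-on-Q i j
    upper (right j) (left i)   lt = ⊥-elim (↑ʳ≮↑ˡ j i lt)
    upper (right j) (right j′) lt = Q.upper j j′ (↑ʳ-cancel-< l lt)

  chain-++ : Chain D (l + k)
  chain-++ = triangular⇒chain
    (λ x → a (splitView l x)) (λ x → c (splitView l x))
    (λ x → c∈D (splitView l x))
    (λ x → diag (splitView l x))
    (λ x y → upper (splitView l x) (splitView l y))

module _ {m : ℕ} {C : Code (Fin m)} {T} {k} (Q : Chain (Restrict C T) k) where
  private
    module Q = Chain Q

    lift : Fin k → Word (Fin m)
    lift j = proj₁ (Q.c∈D j)

    lift-extends : ∀ j x → Q.c j x ≡ lift j (proj₁ x)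
    lift-extends j = proj₂ (proj₂ (Q.c∈D j))

  unrestrict : Chain C k
  unrestrict = triangular⇒chain (λ j → proj₁ (Q.a j)) lift
    (λ j → proj₁ (proj₂ (Q.c∈D j)))
    (λ j → trans (sym (lift-extends j (Q.a j))) (Q.diag j))
    (λ i j i<j → trans (sym (lift-extends i (Q.a j))) (Q.upper i j i<j))

∉Supp⇒≡false : ∀ {m} {C′ : Code (Fin m)} {w x} → C′ w → ¬ Supp C′ x → w x ≡ false
∉Supp⇒≡false w∈C′ x∉Supp = ¬-not λ wₓ≡true → x∉Supp (_ , w∈C′ , wₓ≡true)

claim3p5 : (m : ℕ) (C C' : Code (Fin m)) (ℓ n k : ℕ) →
    C' ⊆c C → IsCL C' ℓ → IsCL C n →
    IsCL (Restrict C (Supp C')) k →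
    k ≤ n ∸ ℓ
claim3p5 m C C' ℓ n k C'⊆C (P , _) (_ , maximal) (Q , _) =
  m+n≤o⇒m≤o∸n k (subst (_≤ n) (+-comm ℓ k) (maximal (ℓ + k) combined))
  where
  combined : Chain C (ℓ + k)
  combined = chain-++ (chain-mono C'⊆C P) (unrestrict Q)
    λ i j → ∉Supp⇒≡false (Chain.c∈D P i) (proj₂ (Chain.a Q j))
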